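{- Let $b$ be a nonzero integer such that $-b$ is not a perfect square and $b$ has a prime divisor $p$ with $p \equiv 5$ or $7 \pmod 8$. A pair $(X, Y)$ with $X, Y \in M_2(\mathbb{Z})$ satisfies $X^2 + bY^2 = -2I$ if and only if one of the following holds: (i) $X = \begin{pmatrix} t_1 & t_2 \\ t_3 & -t_1 \end{pmatrix}$, $Y = \begin{pmatrix} s_1 & s_2 \\ s_3 & -s_1 \end{pmatrix}$ with $t_1, t_2, t_3, s_1, s_2, s_3 \in \mathbb{Z}$ and $t_1^2 + t_2 t_3 + b(s_1^2 + s_2 s_3) = -2$; (ii) if $b > 0$: $X = \begin{pmatrix} t_1 & t_2 \\ t_3 & -t_1 \end{pmatrix}$, $Y = t_4 I$ with $t_1, t_2, t_3, t_4 \in \mathbb{Z}$ and $t_1^2 + t_2 t_3 + b t_4^2 = -2$; if $b < 0$: $X = \begin{pmatrix} t_1 & \frac{u+2}{g} t_2 \\ \frac{u+2}{g} t_3 & \frac{u t_1 + vb t_4}{ -2} \end{pmatrix}$, $Y = \begin{pmatrix} t_4 & \frac{v}{g} t_2 \\ \frac{v}{g} t_3 & \frac{v t_1 - u t_4}{ -2} \end{pmatrix}$, where $t_1, t_2, t_3, t_4, u, v \in \mathbb{Z}$, $u \neq -2$, $g = \gcd(v, u+2)$, and $$u^2 + v^2 b = 4, \qquad t_1^2 + b t_4^2 + \frac{4 t_2 t_3}{g^2}(2 + u) = -2.$$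
   Context: $M_2(\mathbb{Z})$ denotes the ring of $2\times 2$ matrices with integer entries; $I$ is the $2\times 2$ identity matrix. -}

module Defs where

open import Data.Integer using (ℤ; +_; -_; _+_; _*_)

record M2 : Set where
  constructor mat
  field
    m11 m12 m21 m22 : ℤ
open M2 public

infixl 6 _⊕_
infixl 7 _⊗_ _·_

_⊕_ : M2 → M2 → M2
mat a b c d ⊕ mat a' b' c' d' = mat (a + a') (b + b') (c + c') (d + d')

_⊗_ : M2 → M2 → M2
mat a b c d ⊗ mat a' b' c' d' =
  mat (a * a' + b * c') (a * b' + b * d') (c * a' + d * c') (c * b' + d * d')

_·_ : ℤ → M2 → M2
k · mat a b c d = mat (k * a) (k * b) (k * c) (k * d)

I : M2
I = mat (+ 1) (+ 0) (+ 0) (+ 1)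

sq : M2 → M2
sq X = X ⊗ X

{-# OPTIONS --safe #-}
module Submission where

open import Defs
open import Data.Integer using (ℤ; +_; -_; _+_; _-_; _*_; _<_; ∣_∣)
open import Data.Integer.GCD using (gcd)
open import Data.Nat using (ℕ; _%_)
open import Data.Nat.Divisibility using (_∣_)
open import Data.Nat.Primality using (Prime)
open import Data.Product using (_×_; ∃; ∃-syntax)
open import Data.Sum using (_⊎_)
open import Relation.Nullary using (¬_)
open import Function.Bundles using (_⇔_)
open import Relation.Binary.PropositionalEquality using (_≡_; _≢_)

open import Data.Empty using (⊥)
open import Data.Fin using (Fin; toℕ; fromℕ<; remQuot; combine)
open import Data.Fin.Properties using (toℕ-fromℕ<; toℕ-injective; all?; pigeonhole; combine-remQuot)
open import Data.Integer using (-[1+_]; 0ℤ)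
open import Data.List using (List; []; _∷_)
open import Data.List.Relation.Binary.Pointwise using (Pointwise; []; _∷_)
open import Data.Nat using (zero; suc; z≤n; s≤s; NonZero)
open import Data.Nat.Divisibility using (divides)
open import Data.Nat.DivMod using (m≡m%n+[m/n]*n; m%n<n; m%n≤m; [m+kn]%n≡m%n)
open import Data.Nat.Primality using (euclidsLemma; prime[2])
open import Data.Product using (_,_; ∃₂; proj₁; proj₂; uncurry)
open import Data.Sum using (inj₁; inj₂; [_,_]′; map; map₂)
open import Function using (_∘_; _∘′_)
open import Function.Bundles using (mk⇔)
open import Relation.Binary.Definitions using (Tri; tri<; tri≈; tri>)
open import Relation.Binary.PropositionalEquality using (refl; sym; trans; cong; cong₂; subst; module ≡-Reasoning)
open import Relation.Nullary using (contradiction; yes; no)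
open import Relation.Nullary.Decidable using (from-yes; ¬?; _⊎-dec_; decidable-stable)
open import Relation.Unary using (Decidable)
import Data.Fin.Properties as Fin
import Data.Integer.Base as ℤ
import Data.Integer.DivMod as ℤ
import Data.Integer.Divisibility.Signed as ℤ
import Data.Integer.GCD as ℤ
import Data.Integer.Properties as ℤ
import Data.Integer.Tactic.RingSolver as ℤ-Solver
import Data.Nat as ℕ
import Data.Nat.Divisibility as ℕ
import Data.Nat.GCD as ℕ
import Data.Nat.Properties as ℕ
import Data.Nat.Tactic.RingSolver as ℕ-Solver

-- Write a = tr X and c = tr Y. By Cayley–Hamilton, X² + bY² = −2I makes aX₀ + bcY₀ = 0
-- for the traceless parts X₀, Y₀; a = c = 0 is case (i). If c = 0 ≠ a, the off-diagonal
-- entries force x₂ = 0, and then p ∣ b ∣ x₁² + 2. This is impossible since −2 is not a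
-- square modulo p: Thue's lemma gives (σ, τ) ≠ (0, 0) with |σ|, |τ| < √p and p ∣ σ² + 2τ²,
-- so σ² + 2τ² ∈ {p, 2p}, which is excluded modulo 8. In the remaining cases X and Y commute,
-- so Z = X + sY with s² = −b satisfies Z Z̄ = −2I. Hence det Z = u + sv has u² + bv² = 4,
-- and det Z · Z̄ = −2 adj Z gives linear relations between the entries. For b > 0 (so b ≥ 5)
-- they force v = 0 and u = 2 (u = −2 would give c = 0), so Y is scalar: case (ii). For b < 0
-- they give the parametrisation, Bézout making (x₂, y₂) and (x₃, y₃) multiples of
-- (u + 2, v)/g.

-- Certificate d cs as bs unfolds to the polynomial equation d − Σ cᵢ (aᵢ − bᵢ) = 0; the ring
-- solver can check a certificate only because it sees this unfolded form.
Certificate : ℤ → List ℤ → List ℤ → List ℤ → Set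
Certificate d (c ∷ cs) (a ∷ as) (b ∷ bs) = Certificate (d - c * (a - b)) cs as bs
Certificate d _        _        _        = d ≡ 0ℤ

certificate⇒≡0 : ∀ {d as bs} → Pointwise _≡_ as bs → ∀ cs → Certificate d cs as bs → d ≡ 0ℤ
certificate⇒≡0 []                         []       d≡0  = d≡0
certificate⇒≡0 []                         (_ ∷ _)  d≡0  = d≡0
certificate⇒≡0 (_ ∷ _)                    []       d≡0  = d≡0
certificate⇒≡0 {d} (_∷_ {x = a} refl eqs) (c ∷ cs) cert =
  trans (sym (drop d c a)) (certificate⇒≡0 eqs cs cert)
  where
  drop : ∀ d c a → d - c * (a - a) ≡ d
  drop = ℤ-Solver.solve-∀

linear-combination : ∀ {l r as bs} → Pointwise _≡_ as bs → ∀ cs → Certificate (l - r) cs as bs → l ≡ r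
linear-combination {l} {r} eqs cs cert = ℤ.i-j≡0⇒i≡j l r (certificate⇒≡0 eqs cs cert)

i*j≡0⇒j≡0 : ∀ {i j} → i ≢ 0ℤ → i * j ≡ 0ℤ → j ≡ 0ℤ
i*j≡0⇒j≡0 {i} i≢0 = [ (λ i≡0 → contradiction i≡0 i≢0) , (λ j≡0 → j≡0) ]′ ∘′ ℤ.i*j≡0⇒i≡0∨j≡0 i

i*j≢0 : ∀ {i j} → i ≢ 0ℤ → j ≢ 0ℤ → i * j ≢ 0ℤ
i*j≢0 i≢0 j≢0 = j≢0 ∘′ i*j≡0⇒j≡0 i≢0

*-cancelˡ : ∀ {k i j} → k ≢ 0ℤ → k * i ≡ k * j → i ≡ j
*-cancelˡ {k} {i} {j} k≢0 = ℤ.*-cancelˡ-≡ k i j {{ℤ.≢-nonZero k≢0}}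

square≡0 : ∀ {i} → i * i ≡ 0ℤ → i ≡ 0ℤ
square≡0 {i} = [ (λ i≡0 → i≡0) , (λ i≡0 → i≡0) ]′ ∘′ ℤ.i*j≡0⇒i≡0∨j≡0 i

square≡4 : ∀ {u} → u * u ≡ + 4 → u ≡ + 2 ⊎ u ≡ - (+ 2)
square≡4 {u} u²≡4 = map (ℤ.i-j≡0⇒i≡j u (+ 2)) (ℤ.i-j≡0⇒i≡j u (- (+ 2)))
  (ℤ.i*j≡0⇒i≡0∨j≡0 (u - + 2) {u + + 2} (linear-combination (u²≡4 ∷ []) (+ 1 ∷ []) (ℤ-Solver.solve vars)))
  where
  vars : List ℤ
  vars = u ∷ []

+∣i∣*∣i∣≡i*i : ∀ i → + (∣ i ∣ ℕ.* ∣ i ∣) ≡ i * i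
+∣i∣*∣i∣≡i*i (+ n)    = ℤ.pos-* n n
+∣i∣*∣i∣≡i*i -[1+ n ] = refl

+[∣i∣²+k∣j∣²] : ∀ k i j → + (∣ i ∣ ℕ.* ∣ i ∣ ℕ.+ k ℕ.* (∣ j ∣ ℕ.* ∣ j ∣)) ≡ i * i + + k * (j * j)
+[∣i∣²+k∣j∣²] k i j = trans (ℤ.pos-+ (∣ i ∣ ℕ.* ∣ i ∣) (k ℕ.* (∣ j ∣ ℕ.* ∣ j ∣)))
  (cong₂ _+_ (+∣i∣*∣i∣≡i*i i) (trans (ℤ.pos-* k (∣ j ∣ ℕ.* ∣ j ∣)) (cong (+ k *_) (+∣i∣*∣i∣≡i*i j))))

-- −2 is not a square modulo p ≡ 5, 7 (mod 8)

Is5or7mod8 : ℕ → Set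
Is5or7mod8 n = n % 8 ≡ 5 ⊎ n % 8 ≡ 7

is5or7mod8? : Decidable Is5or7mod8
is5or7mod8? n = (n % 8 ℕ.≟ 5) ⊎-dec (n % 8 ℕ.≟ 7)

5or7mod8⇒5≤ : ∀ {p} → Is5or7mod8 p → 5 ℕ.≤ p
5or7mod8⇒5≤ {p} (inj₁ p%8≡5) = subst (ℕ._≤ p) p%8≡5 (m%n≤m p 8)
5or7mod8⇒5≤ {p} (inj₂ p%8≡7) = ℕ.≤-trans (ℕ.m≤m+n 5 2) (subst (ℕ._≤ p) p%8≡7 (m%n≤m p 8))

x²+2y²-mod8 : ∀ s t → (s ℕ.* s ℕ.+ 2 ℕ.* (t ℕ.* t)) % 8 ≡ (s % 8 ℕ.* (s % 8) ℕ.+ 2 ℕ.* (t % 8 ℕ.* (t % 8))) % 8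
x²+2y²-mod8 s t = begin
  (s ℕ.* s ℕ.+ 2 ℕ.* (t ℕ.* t)) % 8
    ≡⟨ cong₂ (λ a b → (a ℕ.* a ℕ.+ 2 ℕ.* (b ℕ.* b)) % 8) (m≡m%n+[m/n]*n s 8) (m≡m%n+[m/n]*n t 8) ⟩
  ((r ℕ.+ q ℕ.* 8) ℕ.* (r ℕ.+ q ℕ.* 8) ℕ.+ 2 ℕ.* ((r′ ℕ.+ q′ ℕ.* 8) ℕ.* (r′ ℕ.+ q′ ℕ.* 8))) % 8
    ≡⟨ cong (_% 8) (expand r q r′ q′) ⟩
  (r ℕ.* r ℕ.+ 2 ℕ.* (r′ ℕ.* r′) ℕ.+ carry ℕ.* 8) % 8
    ≡⟨ [m+kn]%n≡m%n (r ℕ.* r ℕ.+ 2 ℕ.* (r′ ℕ.* r′)) carry 8 ⟩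
  (r ℕ.* r ℕ.+ 2 ℕ.* (r′ ℕ.* r′)) % 8 ∎
  where
  open ≡-Reasoning
  r = s % 8
  q = s ℕ./ 8
  r′ = t % 8
  q′ = t ℕ./ 8
  carry = 2 ℕ.* r ℕ.* q ℕ.+ 8 ℕ.* q ℕ.* q ℕ.+ 4 ℕ.* r′ ℕ.* q′ ℕ.+ 16 ℕ.* q′ ℕ.* q′
  expand : ∀ r q r′ q′ → (r ℕ.+ q ℕ.* 8) ℕ.* (r ℕ.+ q ℕ.* 8) ℕ.+ 2 ℕ.* ((r′ ℕ.+ q′ ℕ.* 8) ℕ.* (r′ ℕ.+ q′ ℕ.* 8))
    ≡ r ℕ.* r ℕ.+ 2 ℕ.* (r′ ℕ.* r′) ℕ.+ (2 ℕ.* r ℕ.* q ℕ.+ 8 ℕ.* q ℕ.* q ℕ.+ 4 ℕ.* r′ ℕ.* q′ ℕ.+ 16 ℕ.* q′ ℕ.* q′) ℕ.* 8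
  expand = ℕ-Solver.solve-∀

x²+2y²-not-5or7mod8 : ∀ s t → ¬ Is5or7mod8 (s ℕ.* s ℕ.+ 2 ℕ.* (t ℕ.* t))
x²+2y²-not-5or7mod8 s t = table (fromℕ< (m%n<n s 8)) (fromℕ< (m%n<n t 8)) ∘ subst (λ n → n ≡ 5 ⊎ n ≡ 7) same-residue
  where
  table : ∀ (i j : Fin 8) → ¬ Is5or7mod8 (toℕ i ℕ.* toℕ i ℕ.+ 2 ℕ.* (toℕ j ℕ.* toℕ j))
  table = from-yes (all? {n = 8} λ i → all? {n = 8} λ j → ¬? (is5or7mod8? (toℕ i ℕ.* toℕ i ℕ.+ 2 ℕ.* (toℕ j ℕ.* toℕ j))))
  same-residue : (s ℕ.* s ℕ.+ 2 ℕ.* (t ℕ.* t)) % 8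
               ≡ (toℕ (fromℕ< (m%n<n s 8)) ℕ.* toℕ (fromℕ< (m%n<n s 8)) ℕ.+ 2 ℕ.* (toℕ (fromℕ< (m%n<n t 8)) ℕ.* toℕ (fromℕ< (m%n<n t 8)))) % 8
  same-residue rewrite toℕ-fromℕ< (m%n<n s 8) | toℕ-fromℕ< (m%n<n t 8) = x²+2y²-mod8 s t

x²+2y²≢2*5or7mod8 : ∀ {p} s t → Is5or7mod8 p → s ℕ.* s ℕ.+ 2 ℕ.* (t ℕ.* t) ≢ 2 ℕ.* p
-- s is even, and halving leaves t² + 2 (s/2)² = p, which is excluded by the residues mod 8.
x²+2y²≢2*5or7mod8 {p} s t p-5or7 eq = [ halve , halve ]′ (euclidsLemma s s prime[2] 2∣s²)
  where
  2∣s² : 2 ∣ s ℕ.* s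
  2∣s² = ℕ.∣m+n∣m⇒∣n (subst (2 ∣_) (trans (sym eq) (ℕ.+-comm (s ℕ.* s) _)) (ℕ.m∣m*n p)) (ℕ.m∣m*n (t ℕ.* t))
  halve : 2 ∣ s → ⊥
  halve (divides q s≡q*2) = x²+2y²-not-5or7mod8 t q (subst Is5or7mod8 (sym half) p-5or7)
    where
    half : t ℕ.* t ℕ.+ 2 ℕ.* (q ℕ.* q) ≡ p
    half = ℕ.*-cancelˡ-≡ _ _ 2 (begin
      2 ℕ.* (t ℕ.* t ℕ.+ 2 ℕ.* (q ℕ.* q))       ≡⟨ double t q ⟩
      q ℕ.* 2 ℕ.* (q ℕ.* 2) ℕ.+ 2 ℕ.* (t ℕ.* t) ≡⟨ cong (λ s → s ℕ.* s ℕ.+ 2 ℕ.* (t ℕ.* t)) (sym s≡q*2) ⟩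
      s ℕ.* s ℕ.+ 2 ℕ.* (t ℕ.* t)               ≡⟨ eq ⟩
      2 ℕ.* p                                   ∎)
      where
      open ≡-Reasoning
      double : ∀ t q → 2 ℕ.* (t ℕ.* t ℕ.+ 2 ℕ.* (q ℕ.* q)) ≡ q ℕ.* 2 ℕ.* (q ℕ.* 2) ℕ.+ 2 ℕ.* (t ℕ.* t)
      double = ℕ-Solver.solve-∀

sqrt-bracket : ∀ n → ∃[ m ] m ℕ.* m ℕ.≤ n × n ℕ.< suc m ℕ.* suc m
sqrt-bracket zero = 0 , z≤n , s≤s z≤n
sqrt-bracket (suc n) with sqrt-bracket n
... | m , m²≤n , n<[1+m]² with ℕ.m≤n⇒m<n∨m≡n n<[1+m]²
...   | inj₁ 1+n<[1+m]² = m , ℕ.m≤n⇒m≤1+n m²≤n , 1+n<[1+m]²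
...   | inj₂ 1+n≡[1+m]² = suc m , ℕ.≤-reflexive (sym 1+n≡[1+m]²) ,
          subst (ℕ._< suc (suc m) ℕ.* suc (suc m)) (sym 1+n≡[1+m]²) (ℕ.*-mono-< (ℕ.n<1+n (suc m)) (ℕ.n<1+n (suc m)))

multiple<3*⇒≡1*⊎≡2* : ∀ {p n} → p ∣ n → n ≢ 0 → n ℕ.< 3 ℕ.* p → n ≡ p ⊎ n ≡ 2 ℕ.* p
multiple<3*⇒≡1*⊎≡2* (divides zero n≡0) n≢0 _ = contradiction n≡0 n≢0
multiple<3*⇒≡1*⊎≡2* (divides 1 n≡1*p) _ _ = inj₁ (trans n≡1*p (ℕ.*-identityˡ _))
multiple<3*⇒≡1*⊎≡2* (divides 2 n≡2*p) _ _ = inj₂ n≡2*p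
multiple<3*⇒≡1*⊎≡2* {p} (divides (suc (suc (suc q))) refl) _ n<3p =
  contradiction n<3p (ℕ.≤⇒≯ (ℕ.*-monoˡ-≤ p {3} {suc (suc (suc q))} (s≤s (s≤s (s≤s z≤n)))))

residues≡⇒∣- : ∀ a b p .{{_ : NonZero p}} → a ℤ.%ℕ p ≡ b ℤ.%ℕ p → + p ℤ.∣ a - b
residues≡⇒∣- a b p same = ℤ.divides (a ℤ./ℕ p - b ℤ./ℕ p) (begin
  a - b
    ≡⟨ cong₂ _-_ (ℤ.a≡a%ℕn+[a/ℕn]*n a p) (ℤ.a≡a%ℕn+[a/ℕn]*n b p) ⟩
  (+ (a ℤ.%ℕ p) + a ℤ./ℕ p * + p) - (+ (b ℤ.%ℕ p) + b ℤ./ℕ p * + p)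
    ≡⟨ cong (λ r → (+ (a ℤ.%ℕ p) + a ℤ./ℕ p * + p) - (+ r + b ℤ./ℕ p * + p)) (sym same) ⟩
  (+ (a ℤ.%ℕ p) + a ℤ./ℕ p * + p) - (+ (a ℤ.%ℕ p) + b ℤ./ℕ p * + p)
    ≡⟨ cancel (+ (a ℤ.%ℕ p)) (a ℤ./ℕ p) (b ℤ./ℕ p) (+ p) ⟩
  (a ℤ./ℕ p - b ℤ./ℕ p) * + p ∎)
  where
  open ≡-Reasoning
  cancel : ∀ r u v q → (r + u * q) - (r + v * q) ≡ (u - v) * q
  cancel = ℤ-Solver.solve-∀

∣+m-+n∣≤ : ∀ {m n k} → m ℕ.≤ k → n ℕ.≤ k → ∣ + m - + n ∣ ℕ.≤ k
∣+m-+n∣≤ {m} {n} m≤k n≤k = subst (ℕ._≤ _) (cong ∣_∣ (sym (ℤ.m-n≡m⊖n m n))) (ℕ.≤-trans (ℤ.∣m⊝n∣≤m⊔n m n) (ℕ.⊔-lub m≤k n≤k))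

thue : ∀ p x m .{{_ : NonZero p}} → p ℕ.< suc m ℕ.* suc m →
       ∃₂ λ σ τ → ¬ (σ ≡ 0ℤ × τ ≡ 0ℤ) × ∣ σ ∣ ℕ.≤ m × ∣ τ ∣ ℕ.≤ m × + p ℤ.∣ σ + x * τ
thue p x m p<[1+m]² = collision (pigeonhole p<[1+m]² residue)
  where
  pair : Fin (suc m ℕ.* suc m) → Fin (suc m) × Fin (suc m)
  pair = remQuot {suc m} (suc m)
  s t : Fin (suc m ℕ.* suc m) → ℕ
  s k = toℕ (proj₁ (pair k))
  t k = toℕ (proj₂ (pair k))
  value : Fin (suc m ℕ.* suc m) → ℤ
  value k = + s k + x * + t k
  residue : Fin (suc m ℕ.* suc m) → Fin p
  residue k = fromℕ< (ℤ.n%ℕd<d (value k) p)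
  collision : ∃₂ (λ k l → k Data.Fin.< l × residue k ≡ residue l) →
              ∃₂ λ σ τ → ¬ (σ ≡ 0ℤ × τ ≡ 0ℤ) × ∣ σ ∣ ℕ.≤ m × ∣ τ ∣ ℕ.≤ m × + p ℤ.∣ σ + x * τ
  collision (k , l , k<l , same) =
    + s k - + s l , + t k - + t l , distinct ,
    ∣+m-+n∣≤ (bound (proj₁ (pair k))) (bound (proj₁ (pair l))) ,
    ∣+m-+n∣≤ (bound (proj₂ (pair k))) (bound (proj₂ (pair l))) ,
    subst (+ p ℤ.∣_) difference (residues≡⇒∣- (value k) (value l) p same-residue)
    where
    bound : (i : Fin (suc m)) → toℕ i ℕ.≤ m
    bound i = ℕ.s≤s⁻¹ (Fin.toℕ<n i)
    same-residue : value k ℤ.%ℕ p ≡ value l ℤ.%ℕ p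
    same-residue = trans (sym (toℕ-fromℕ< _)) (trans (cong toℕ same) (toℕ-fromℕ< _))
    difference : value k - value l ≡ (+ s k - + s l) + x * (+ t k - + t l)
    difference = regroup (+ s k) (+ s l) (+ t k) (+ t l) x
      where
      regroup : ∀ a b c d x → (a + x * c) - (b + x * d) ≡ (a - b) + x * (c - d)
      regroup = ℤ-Solver.solve-∀
    equal-entries : ∀ {i j} → + i - + j ≡ 0ℤ → i ≡ j
    equal-entries = ℤ.+-injective ∘ ℤ.i-j≡0⇒i≡j _ _
    distinct : ¬ (+ s k - + s l ≡ 0ℤ × + t k - + t l ≡ 0ℤ)
    distinct (σ≡0 , τ≡0) = Fin.<-irrefl k≡l k<l
      where
      k≡l : k ≡ l
      k≡l = trans (sym (combine-remQuot {suc m} (suc m) k))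
                  (trans (cong unpair same-pair) (combine-remQuot {suc m} (suc m) l))
        where
        unpair : Fin (suc m) × Fin (suc m) → Fin (suc m ℕ.* suc m)
        unpair = uncurry combine
        same-pair : pair k ≡ pair l
        same-pair = cong₂ _,_ (toℕ-injective (equal-entries σ≡0)) (toℕ-injective (equal-entries τ≡0))

square-not-5or7mod8 : ∀ k → ¬ Is5or7mod8 (k ℕ.* k)
square-not-5or7mod8 k = x²+2y²-not-5or7mod8 k 0 ∘ subst Is5or7mod8 (sym (ℕ.+-identityʳ (k ℕ.* k)))

small-x²+2y²-not-multiple : ∀ {p m} σ τ → Is5or7mod8 p → m ℕ.* m ℕ.≤ p → ∣ σ ∣ ℕ.≤ m → ∣ τ ∣ ℕ.≤ m →
                            ¬ (σ ≡ 0ℤ × τ ≡ 0ℤ) → ¬ (+ p ℤ.∣ σ * σ + + 2 * (τ * τ))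
small-x²+2y²-not-multiple {p} {m} σ τ p-5or7 m²≤p ∣σ∣≤m ∣τ∣≤m nonzero p∣ =
  [ (λ N≡p → x²+2y²-not-5or7mod8 ∣ σ ∣ ∣ τ ∣ (subst Is5or7mod8 (sym N≡p) p-5or7))
  , x²+2y²≢2*5or7mod8 {p} ∣ σ ∣ ∣ τ ∣ p-5or7 ]′
  (multiple<3*⇒≡1*⊎≡2* {p} {N} p∣N N≢0 N<3p)
  where
  N = ∣ σ ∣ ℕ.* ∣ σ ∣ ℕ.+ 2 ℕ.* (∣ τ ∣ ℕ.* ∣ τ ∣)
  m²<p : m ℕ.* m ℕ.< p
  m²<p = ℕ.≤∧≢⇒< m²≤p (λ m²≡p → square-not-5or7mod8 m (subst Is5or7mod8 (sym m²≡p) p-5or7))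
  p∣N : p ∣ N
  p∣N = subst (p ∣_) (cong ∣_∣ (sym (+[∣i∣²+k∣j∣²] 2 σ τ))) (ℤ.∣⇒∣ᵤ p∣)
  N<3p : N ℕ.< 3 ℕ.* p
  N<3p = ℕ.≤-<-trans (ℕ.+-mono-≤ (ℕ.*-mono-≤ ∣σ∣≤m ∣σ∣≤m) (ℕ.*-monoʳ-≤ 2 (ℕ.*-mono-≤ ∣τ∣≤m ∣τ∣≤m)))
                      (ℕ.*-monoʳ-< 3 m²<p)
  m*m≡0⇒m≡0 : ∀ n → n ℕ.* n ≡ 0 → n ≡ 0
  m*m≡0⇒m≡0 n = [ (λ eq → eq) , (λ eq → eq) ]′ ∘ ℕ.m*n≡0⇒m≡0∨n≡0 n
  N≢0 : N ≢ 0
  N≢0 N≡0 = nonzero (ℤ.∣i∣≡0⇒i≡0 (m*m≡0⇒m≡0 ∣ σ ∣ (ℕ.m+n≡0⇒m≡0 _ N≡0)) ,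
                     ℤ.∣i∣≡0⇒i≡0 (m*m≡0⇒m≡0 ∣ τ ∣ (ℕ.m+n≡0⇒m≡0 _ (ℕ.m+n≡0⇒n≡0 (∣ σ ∣ ℕ.* ∣ σ ∣) N≡0))))

-2-nonresidue : ∀ {p} x → Is5or7mod8 p → ¬ (+ p ℤ.∣ x * x + + 2)
-2-nonresidue {zero} _ (inj₁ ())
-2-nonresidue {zero} _ (inj₂ ())
-2-nonresidue {p@(suc _)} x p-5or7 p∣x²+2 =
  let m , m²≤p , p<[1+m]² = sqrt-bracket p
      σ , τ , nonzero , ∣σ∣≤m , ∣τ∣≤m , p∣σ+xτ = thue p x m p<[1+m]²
  in small-x²+2y²-not-multiple σ τ p-5or7 m²≤p ∣σ∣≤m ∣τ∣≤m nonzero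
       (subst (+ p ℤ.∣_) (sym (factor σ τ x))
              (ℤ.∣m∣n⇒∣m+n (ℤ.∣m⇒∣m*n (σ - x * τ) p∣σ+xτ) (ℤ.∣n⇒∣m*n (τ * τ) p∣x²+2)))
  where
  factor : ∀ σ τ x → σ * σ + + 2 * (τ * τ) ≡ (σ + x * τ) * (σ - x * τ) + τ * τ * (x * x + + 2)
  factor = ℤ-Solver.solve-∀

-- Bézout's identity for gcd on ℤ

+∣i∣≡±i : ∀ i → ∃[ σ ] + ∣ i ∣ ≡ σ * i
+∣i∣≡±i (+ n)    = + 1 , sym (ℤ.*-identityˡ (+ n))
+∣i∣≡±i -[1+ n ] = - (+ 1) , sym (ℤ.-1*i≡-i -[1+ n ])

pos-identity : ∀ d m n x y → d ℕ.+ y ℕ.* n ≡ x ℕ.* m → + d + + y * + n ≡ + x * + m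
pos-identity d m n x y eq = begin
  + d + + y * + n    ≡⟨ cong (_+_ (+ d)) (sym (ℤ.pos-* y n)) ⟩
  + d + + (y ℕ.* n)  ≡⟨ sym (ℤ.pos-+ d (y ℕ.* n)) ⟩
  + (d ℕ.+ y ℕ.* n)  ≡⟨ cong +_ eq ⟩
  + (x ℕ.* m)        ≡⟨ ℤ.pos-* x m ⟩
  + x * + m          ∎
  where open ≡-Reasoning

d+yb≡xa⇒d≡xa-yb : ∀ d a b x y → d + y * b ≡ x * a → d ≡ x * a + - y * b
d+yb≡xa⇒d≡xa-yb d a b x y eq = linear-combination (eq ∷ []) (+ 1 ∷ []) (ℤ-Solver.solve vars)
  where
  vars : List ℤ
  vars = d ∷ a ∷ b ∷ x ∷ y ∷ []

ℕ-bézout : ∀ m n → ∃₂ λ r s → + ℕ.gcd m n ≡ r * + m + s * + n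
ℕ-bézout m n with ℕ.Bézout.identity (ℕ.gcd-GCD m n)
... | ℕ.Bézout.+- x y eq =
  + x , - (+ y) , d+yb≡xa⇒d≡xa-yb (+ ℕ.gcd m n) (+ m) (+ n) (+ x) (+ y) (pos-identity (ℕ.gcd m n) m n x y eq)
... | ℕ.Bézout.-+ x y eq =
  - (+ x) , + y , trans (d+yb≡xa⇒d≡xa-yb (+ ℕ.gcd m n) (+ n) (+ m) (+ y) (+ x) (pos-identity (ℕ.gcd m n) n m y x eq))
                        (ℤ.+-comm (+ y * + n) (- (+ x) * + m))

bézout : ∀ i j → ∃₂ λ r s → gcd i j ≡ r * i + s * j
bézout i j =
  let r , s , g≡ = ℕ-bézout ∣ i ∣ ∣ j ∣
      σ , ∣i∣≡σi = +∣i∣≡±i i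
      ρ , ∣j∣≡ρj = +∣i∣≡±i j
  in r * σ , s * ρ , (begin
    gcd i j                    ≡⟨ g≡ ⟩
    r * + ∣ i ∣ + s * + ∣ j ∣  ≡⟨ cong₂ (λ a b → r * a + s * b) ∣i∣≡σi ∣j∣≡ρj ⟩
    r * (σ * i) + s * (ρ * j)  ≡⟨ cong₂ _+_ (sym (ℤ.*-assoc r σ i)) (sym (ℤ.*-assoc s ρ j)) ⟩
    r * σ * i + s * ρ * j      ∎)
  where open ≡-Reasoning

multiple-of-bézout : ∀ g r s v w x y → g ≡ r * v + s * w → w * y ≡ v * x →
                     g * x ≡ w * (r * y + s * x) × g * y ≡ v * (r * y + s * x)
multiple-of-bézout g r s v w x y g≡ wy≡vx =
  linear-combination (g≡ ∷ wy≡vx ∷ []) (x ∷ - r ∷ []) (ℤ-Solver.solve vars) ,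
  linear-combination (g≡ ∷ wy≡vx ∷ []) (y ∷ s ∷ []) (ℤ-Solver.solve vars)
  where
  vars : List ℤ
  vars = g ∷ r ∷ s ∷ v ∷ w ∷ x ∷ y ∷ []

proportional⇒multiple : ∀ {v w x y} → w * y ≡ v * x → ∃[ t ] (gcd v w * x ≡ w * t × gcd v w * y ≡ v * t)
proportional⇒multiple {v} {w} {x} {y} wy≡vx =
  let r , s , g≡ = bézout v w in r * y + s * x , multiple-of-bézout (gcd v w) r s v w x y g≡ wy≡vx

minors-vanish : ∀ {s t p₁ p₂ p₃ q₁ q₂ q₃} →
                s * p₁ + t * q₁ ≡ 0ℤ → s * p₂ + t * q₂ ≡ 0ℤ → s * p₃ + t * q₃ ≡ 0ℤ → s ≢ 0ℤ ⊎ t ≢ 0ℤ →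
                p₂ * q₃ ≡ p₃ * q₂ × p₁ * q₂ ≡ p₂ * q₁ × p₁ * q₃ ≡ p₃ * q₁
minors-vanish {s} {t} {p₁} {p₂} {p₃} {q₁} {q₂} {q₃} h₁ h₂ h₃ (inj₁ s≢0) =
  *-cancelˡ s≢0 (linear-combination (h₂ ∷ h₃ ∷ []) (q₃ ∷ - q₂ ∷ []) (ℤ-Solver.solve vars)) ,
  *-cancelˡ s≢0 (linear-combination (h₁ ∷ h₂ ∷ []) (q₂ ∷ - q₁ ∷ []) (ℤ-Solver.solve vars)) ,
  *-cancelˡ s≢0 (linear-combination (h₁ ∷ h₃ ∷ []) (q₃ ∷ - q₁ ∷ []) (ℤ-Solver.solve vars))
  where
  vars : List ℤ
  vars = s ∷ t ∷ p₁ ∷ p₂ ∷ p₃ ∷ q₁ ∷ q₂ ∷ q₃ ∷ []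
minors-vanish {s} {t} {p₁} {p₂} {p₃} {q₁} {q₂} {q₃} h₁ h₂ h₃ (inj₂ t≢0) =
  *-cancelˡ t≢0 (linear-combination (h₃ ∷ h₂ ∷ []) (p₂ ∷ - p₃ ∷ []) (ℤ-Solver.solve vars)) ,
  *-cancelˡ t≢0 (linear-combination (h₂ ∷ h₁ ∷ []) (p₁ ∷ - p₂ ∷ []) (ℤ-Solver.solve vars)) ,
  *-cancelˡ t≢0 (linear-combination (h₃ ∷ h₁ ∷ []) (p₁ ∷ - p₃ ∷ []) (ℤ-Solver.solve vars))
  where
  vars : List ℤ
  vars = s ∷ t ∷ p₁ ∷ p₂ ∷ p₃ ∷ q₁ ∷ q₂ ∷ q₃ ∷ []

m+n*k²≡4⇒k≡0 : ∀ {m n} k → 5 ℕ.≤ n → m ℕ.+ n ℕ.* (k ℕ.* k) ≡ 4 → k ≡ 0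
m+n*k²≡4⇒k≡0         zero    _   _  = refl
m+n*k²≡4⇒k≡0 {m} {n} (suc k) 5≤n eq = contradiction
  (ℕ.≤-trans 5≤n (ℕ.≤-trans (ℕ.m≤m*n n (suc k ℕ.* suc k)) (ℕ.≤-trans (ℕ.m≤n+m _ m) (ℕ.≤-reflexive eq))))
  (ℕ.n≮n 4)

u²+bv²≡4⇒v≡0 : ∀ {b u v} → + 0 < b → 5 ℕ.≤ ∣ b ∣ → u * u + v * v * b ≡ + 4 → v ≡ 0ℤ
u²+bv²≡4⇒v≡0 {+ n} {u} {v} _ 5≤n norm = ℤ.∣i∣≡0⇒i≡0 (m+n*k²≡4⇒k≡0 ∣ v ∣ 5≤n (ℤ.+-injective (begin
  + (∣ u ∣ ℕ.* ∣ u ∣ ℕ.+ n ℕ.* (∣ v ∣ ℕ.* ∣ v ∣)) ≡⟨ +[∣i∣²+k∣j∣²] n u v ⟩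
  u * u + + n * (v * v)                         ≡⟨ cong (_+_ (u * u)) (ℤ.*-comm (+ n) (v * v)) ⟩
  u * u + v * v * + n                           ≡⟨ norm ⟩
  + 4                                           ∎)))
  where open ≡-Reasoning

i+j≡0⇒j≡-i : ∀ {i j} → i + j ≡ 0ℤ → j ≡ - i
i+j≡0⇒j≡-i {i} {j} i+j≡0 = linear-combination (i+j≡0 ∷ []) (+ 1 ∷ []) (ℤ-Solver.solve vars)
  where
  vars : List ℤ
  vars = i ∷ j ∷ []

u²+bv²≡4⇒u≡±2 : ∀ {b u v} → v ≡ 0ℤ → u * u + v * v * b ≡ + 4 → u ≡ + 2 ⊎ u ≡ - (+ 2)
u²+bv²≡4⇒u≡±2 {b} {u} {v} v≡0 norm =
  square≡4 (linear-combination (norm ∷ v≡0 ∷ []) (+ 1 ∷ - (v * b) ∷ []) (ℤ-Solver.solve vars))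
  where
  vars : List ℤ
  vars = b ∷ u ∷ v ∷ []

Solution : ℤ → M2 → M2 → Set
Solution b X Y = sq X ⊕ b · sq Y ≡ (- (+ 2)) · I

TracelessSolution ScalarSolution ParametrisedSolution : ℤ → M2 → M2 → Set
TracelessSolution b X Y =
  ∃[ t₁ ] ∃[ t₂ ] ∃[ t₃ ] ∃[ s₁ ] ∃[ s₂ ] ∃[ s₃ ]
    (X ≡ mat t₁ t₂ t₃ (- t₁) × Y ≡ mat s₁ s₂ s₃ (- s₁)
     × t₁ * t₁ + t₂ * t₃ + b * (s₁ * s₁ + s₂ * s₃) ≡ - (+ 2))
ScalarSolution b X Y =
  ∃[ t₁ ] ∃[ t₂ ] ∃[ t₃ ] ∃[ t₄ ]
    (X ≡ mat t₁ t₂ t₃ (- t₁) × Y ≡ t₄ · I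
     × t₁ * t₁ + t₂ * t₃ + b * (t₄ * t₄) ≡ - (+ 2))
ParametrisedSolution b X Y =
  ∃[ t₁ ] ∃[ t₂ ] ∃[ t₃ ] ∃[ t₄ ] ∃[ u ] ∃[ v ]
    (u ≢ - (+ 2)
     × u * u + v * v * b ≡ + 4
     × gcd v (u + + 2) * gcd v (u + + 2) * (t₁ * t₁ + b * (t₄ * t₄))
         + + 4 * t₂ * t₃ * (+ 2 + u)
       ≡ - (+ 2) * (gcd v (u + + 2) * gcd v (u + + 2))
     × m11 X ≡ t₁
     × gcd v (u + + 2) * m12 X ≡ (u + + 2) * t₂
     × gcd v (u + + 2) * m21 X ≡ (u + + 2) * t₃
     × - (+ 2) * m22 X ≡ u * t₁ + v * b * t₄
     × m11 Y ≡ t₄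
     × gcd v (u + + 2) * m12 Y ≡ v * t₂
     × gcd v (u + + 2) * m21 Y ≡ v * t₃
     × - (+ 2) * m22 Y ≡ v * t₁ - u * t₄)

Classification : ℤ → M2 → M2 → Set
Classification b X Y =
  TracelessSolution b X Y ⊎ ((+ 0 < b × ScalarSolution b X Y) ⊎ (b < + 0 × ParametrisedSolution b X Y))

entrywise : ∀ {a b c d a′ b′ c′ d′} → a ≡ a′ → b ≡ b′ → c ≡ c′ → d ≡ d′ → mat a b c d ≡ mat a′ b′ c′ d′
entrywise refl refl refl refl = refl

-- Every solution belongs to a family

parametrisation-condition :
  ∀ b g u v x₁ x₂ x₃ y₁ y₂ y₃ t₂ t₃ →
  u * u + v * v * b ≡ + 4 →
  g * x₂ ≡ (u + + 2) * t₂ → g * x₃ ≡ (u + + 2) * t₃ → g * y₂ ≡ v * t₂ → g * y₃ ≡ v * t₃ →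
  x₁ * x₁ + x₂ * x₃ + b * (y₁ * y₁ + y₂ * y₃) ≡ - (+ 2) →
  g * g * (x₁ * x₁ + b * (y₁ * y₁)) + + 4 * t₂ * t₃ * (+ 2 + u) ≡ - (+ 2) * (g * g)
parametrisation-condition b g u v x₁ x₂ x₃ y₁ y₂ y₃ t₂ t₃ norm gx₂ gx₃ gy₂ gy₃ e₁₁ =
  linear-combination (norm ∷ gx₂ ∷ gx₃ ∷ gy₂ ∷ gy₃ ∷ e₁₁ ∷ [])
    (- (t₂ * t₃) ∷ - (g * x₃) ∷ - ((u + + 2) * t₂) ∷ - (b * g * y₃) ∷ - (b * v * t₂) ∷ g * g ∷ [])
    (ℤ-Solver.solve vars)
  where
  vars : List ℤ
  vars = b ∷ g ∷ u ∷ v ∷ x₁ ∷ x₂ ∷ x₃ ∷ y₁ ∷ y₂ ∷ y₃ ∷ t₂ ∷ t₃ ∷ []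

-- The entries of X² + bY² = −2I for X = [[x₁, x₂], [x₃, x₄]] and Y = [[y₁, y₂], [y₃, y₄]].
module _ (b x₁ x₂ x₃ x₄ y₁ y₂ y₃ y₄ : ℤ)
         (e₁₁ : x₁ * x₁ + x₂ * x₃ + b * (y₁ * y₁ + y₂ * y₃) ≡ - (+ 2))
         (e₁₂ : x₁ * x₂ + x₂ * x₄ + b * (y₁ * y₂ + y₂ * y₄) ≡ 0ℤ)
         (e₂₁ : x₃ * x₁ + x₄ * x₃ + b * (y₃ * y₁ + y₄ * y₃) ≡ 0ℤ)
         (e₂₂ : x₃ * x₂ + x₄ * x₄ + b * (y₃ * y₂ + y₄ * y₄) ≡ - (+ 2)) where

  private
    vars : List ℤ
    vars = b ∷ x₁ ∷ x₂ ∷ x₃ ∷ x₄ ∷ y₁ ∷ y₂ ∷ y₃ ∷ y₄ ∷ []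

  -- By Cayley–Hamilton tr X · X + b tr Y · Y is scalar, that is tr X · X₀ + b tr Y · Y₀ = 0
  -- for the traceless parts, written as X₀ = (x₁ − x₄, x₂, x₃) and Y₀ = (y₁ − y₄, y₂, y₃).
  cayley-hamilton₁₁ : (x₁ + x₄) * (x₁ - x₄) + b * (y₁ + y₄) * (y₁ - y₄) ≡ 0ℤ
  cayley-hamilton₁₁ = linear-combination (e₁₁ ∷ e₂₂ ∷ []) (+ 1 ∷ - (+ 1) ∷ []) (ℤ-Solver.solve vars)

  cayley-hamilton₁₂ : (x₁ + x₄) * x₂ + b * (y₁ + y₄) * y₂ ≡ 0ℤ
  cayley-hamilton₁₂ = linear-combination (e₁₂ ∷ []) (+ 1 ∷ []) (ℤ-Solver.solve vars)

  cayley-hamilton₂₁ : (x₁ + x₄) * x₃ + b * (y₁ + y₄) * y₃ ≡ 0ℤ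
  cayley-hamilton₂₁ = linear-combination (e₂₁ ∷ []) (+ 1 ∷ []) (ℤ-Solver.solve vars)

  trY≡0⇒trX≡0 : ∀ {p} → Is5or7mod8 p → p ∣ ∣ b ∣ → y₁ + y₄ ≡ 0ℤ → x₁ + x₄ ≡ 0ℤ
  trY≡0⇒trX≡0 {p} p-5or7 p∣b trY≡0 = decidable-stable (x₁ + x₄ ℤ.≟ 0ℤ) λ trX≢0 →
    -2-nonresidue x₁ p-5or7
      (subst (+ p ℤ.∣_) (sym (x₁²+2≡b*w trX≢0))
             (ℤ.∣m⇒∣m*n {+ p} {b} (- (y₁ * y₁ + y₂ * y₃)) (ℤ.∣ᵤ⇒∣ {+ p} {b} p∣b)))
    where
    x₂≡0 : x₁ + x₄ ≢ 0ℤ → x₂ ≡ 0ℤ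
    x₂≡0 trX≢0 = i*j≡0⇒j≡0 trX≢0
      (linear-combination (cayley-hamilton₁₂ ∷ trY≡0 ∷ []) (+ 1 ∷ - (b * y₂) ∷ []) (ℤ-Solver.solve vars))
    x₁²+2≡b*w : x₁ + x₄ ≢ 0ℤ → x₁ * x₁ + + 2 ≡ b * - (y₁ * y₁ + y₂ * y₃)
    x₁²+2≡b*w trX≢0 = linear-combination (e₁₁ ∷ x₂≡0 trX≢0 ∷ []) (+ 1 ∷ - x₃ ∷ []) (ℤ-Solver.solve vars)

  -- XY = YX, as the vanishing of the 2 × 2 minors of X₀ and Y₀
  Commute : Set
  Commute = x₂ * y₃ ≡ x₃ * y₂ × (x₁ - x₄) * y₂ ≡ x₂ * (y₁ - y₄) × (x₁ - x₄) * y₃ ≡ x₃ * (y₁ - y₄)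

  commute : b ≢ 0ℤ → x₁ + x₄ ≢ 0ℤ ⊎ y₁ + y₄ ≢ 0ℤ → Commute
  commute b≢0 = minors-vanish cayley-hamilton₁₁ cayley-hamilton₁₂ cayley-hamilton₂₁ ∘′ map₂ (i*j≢0 b≢0)

  -- det (X + sY) = u + s v whenever s² = −b
  IsU IsV : ℤ → Set
  IsU u = u ≡ x₁ * x₄ - x₂ * x₃ - b * (y₁ * y₄ - y₂ * y₃)
  IsV v = v ≡ x₁ * y₄ + x₄ * y₁ - x₂ * y₃ - x₃ * y₂

  -- When XY = YX, Z = X + sY satisfies Z Z̄ = −2I, hence det Z · det Z̄ = 4 and
  -- det Z · Z̄ = −2 adj Z; the following lemmas are parts of these two identities.
  norm : ∀ {u v} → Commute → IsU u → IsV v → u * u + v * v * b ≡ + 4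
  norm (κ₁ , κ₂ , _) refl refl =
    linear-combination (e₁₁ ∷ e₂₂ ∷ e₁₂ ∷ κ₁ ∷ κ₂ ∷ [])
      (x₃ * x₂ + x₄ * x₄ + b * (y₃ * y₂ + y₄ * y₄) ∷ - (+ 2) ∷ - (x₃ * x₁ + x₄ * x₃ + b * (y₃ * y₁ + y₄ * y₃))
       ∷ b * (x₂ * y₃ - x₃ * y₂) ∷ - (b * ((x₁ - x₄) * y₃ - x₃ * (y₁ - y₄))) ∷ [])
      (ℤ-Solver.solve vars)

  x₄-relation : ∀ {u v} → Commute → IsU u → IsV v → - (+ 2) * x₄ ≡ u * x₁ + v * b * y₁
  x₄-relation (κ₁ , _ , κ₃) refl refl =
    linear-combination (e₁₁ ∷ e₂₁ ∷ κ₁ ∷ κ₃ ∷ []) (- x₄ ∷ x₂ ∷ - (b * y₄) ∷ - (b * y₂) ∷ []) (ℤ-Solver.solve vars)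

  y₄-relation : ∀ {u v} → Commute → IsU u → IsV v → - (+ 2) * y₄ ≡ v * x₁ - u * y₁
  y₄-relation (κ₁ , _ , κ₃) refl refl =
    linear-combination (e₁₁ ∷ e₂₁ ∷ κ₁ ∷ κ₃ ∷ []) (- y₄ ∷ y₂ ∷ x₄ ∷ x₂ ∷ []) (ℤ-Solver.solve vars)

  proportional₂ : ∀ {u v} → Commute → IsU u → IsV v → (u + + 2) * y₂ ≡ v * x₂
  proportional₂ (κ₁ , κ₂ , _) refl refl =
    linear-combination (e₁₂ ∷ e₂₂ ∷ κ₂ ∷ κ₁ ∷ []) (- y₄ ∷ y₂ ∷ x₄ ∷ x₂ ∷ []) (ℤ-Solver.solve vars)

  proportional₃ : ∀ {u v} → Commute → IsU u → IsV v → (u + + 2) * y₃ ≡ v * x₃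
  proportional₃ (κ₁ , _ , κ₃) refl refl =
    linear-combination (e₁₁ ∷ e₂₁ ∷ κ₁ ∷ κ₃ ∷ []) (y₃ ∷ - y₁ ∷ - x₃ ∷ - x₁ ∷ []) (ℤ-Solver.solve vars)

  u≡-2⇒trY≡0 : ∀ {u v} → b ≢ 0ℤ → Commute → IsU u → IsV v → u ≡ - (+ 2) → y₁ + y₄ ≡ 0ℤ
  u≡-2⇒trY≡0 {u} {v} b≢0 κ u≡ v≡ u≡-2 = i*j≡0⇒j≡0 {+ 2} (λ ())
    (linear-combination (y₄-relation κ u≡ v≡ ∷ v≡0 ∷ u≡-2 ∷ []) (- (+ 1) ∷ - x₁ ∷ y₁ ∷ []) (ℤ-Solver.solve vars′))
    where
    vars′ : List ℤ
    vars′ = u ∷ v ∷ vars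
    v≡0 : v ≡ 0ℤ
    v≡0 = square≡0 (i*j≡0⇒j≡0 b≢0
      (linear-combination (norm κ u≡ v≡ ∷ u≡-2 ∷ []) (+ 1 ∷ - (u - + 2) ∷ []) (ℤ-Solver.solve vars′)))

  entries⇒scalar : ∀ {u v} → Commute → IsU u → IsV v → u ≡ + 2 → v ≡ 0ℤ →
                   ScalarSolution b (mat x₁ x₂ x₃ x₄) (mat y₁ y₂ y₃ y₄)
  entries⇒scalar {u} {v} κ u≡ v≡ u≡2 v≡0 = x₁ , x₂ , x₃ , y₁ , cong (mat x₁ x₂ x₃) x₄≡-x₁ , Y≡y₁I , equation
    where
    vars′ : List ℤ
    vars′ = u ∷ v ∷ vars
    x₄≡-x₁ : x₄ ≡ - x₁
    x₄≡-x₁ = *-cancelˡ {+ 2} (λ ()) (linear-combination (x₄-relation κ u≡ v≡ ∷ u≡2 ∷ v≡0 ∷ [])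
                                       (- (+ 1) ∷ - x₁ ∷ - (b * y₁) ∷ []) (ℤ-Solver.solve vars′))
    y₂≡0 : y₂ ≡ 0ℤ
    y₂≡0 = *-cancelˡ {+ 4} (λ ()) (linear-combination (proportional₂ κ u≡ v≡ ∷ u≡2 ∷ v≡0 ∷ [])
                                     (+ 1 ∷ - y₂ ∷ x₂ ∷ []) (ℤ-Solver.solve vars′))
    y₃≡0 : y₃ ≡ 0ℤ
    y₃≡0 = *-cancelˡ {+ 4} (λ ()) (linear-combination (proportional₃ κ u≡ v≡ ∷ u≡2 ∷ v≡0 ∷ [])
                                     (+ 1 ∷ - y₃ ∷ x₃ ∷ []) (ℤ-Solver.solve vars′))
    y₄≡y₁ : y₄ ≡ y₁
    y₄≡y₁ = *-cancelˡ {+ 2} (λ ()) (linear-combination (y₄-relation κ u≡ v≡ ∷ u≡2 ∷ v≡0 ∷ [])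
                                      (- (+ 1) ∷ y₁ ∷ - x₁ ∷ []) (ℤ-Solver.solve vars′))
    Y≡y₁I : mat y₁ y₂ y₃ y₄ ≡ y₁ · I
    Y≡y₁I = entrywise (sym (ℤ.*-identityʳ y₁)) (trans y₂≡0 (sym (ℤ.*-zeroʳ y₁)))
                      (trans y₃≡0 (sym (ℤ.*-zeroʳ y₁))) (trans y₄≡y₁ (sym (ℤ.*-identityʳ y₁)))
    equation : x₁ * x₁ + x₂ * x₃ + b * (y₁ * y₁) ≡ - (+ 2)
    equation = linear-combination (e₁₁ ∷ y₂≡0 ∷ []) (+ 1 ∷ - (b * y₃) ∷ []) (ℤ-Solver.solve vars)

  entries⇒parametrised : ∀ {u v} → Commute → IsU u → IsV v → u ≢ - (+ 2) →
                         ParametrisedSolution b (mat x₁ x₂ x₃ x₄) (mat y₁ y₂ y₃ y₄)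
  entries⇒parametrised {u} {v} κ u≡ v≡ u≢-2 =
    x₁ , t₂ , t₃ , y₁ , u , v , u≢-2 , norm κ u≡ v≡ ,
    parametrisation-condition b g u v x₁ x₂ x₃ y₁ y₂ y₃ t₂ t₃ (norm κ u≡ v≡) gx₂ gx₃ gy₂ gy₃ e₁₁ ,
    refl , gx₂ , gx₃ , x₄-relation κ u≡ v≡ , refl , gy₂ , gy₃ , y₄-relation κ u≡ v≡
    where
    g = gcd v (u + + 2)
    multiple₂ = proportional⇒multiple {v} {u + + 2} {x₂} {y₂} (proportional₂ κ u≡ v≡)
    multiple₃ = proportional⇒multiple {v} {u + + 2} {x₃} {y₃} (proportional₃ κ u≡ v≡)
    t₂ = proj₁ multiple₂
    t₃ = proj₁ multiple₃
    gx₂ : g * x₂ ≡ (u + + 2) * t₂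
    gx₂ = proj₁ (proj₂ multiple₂)
    gy₂ : g * y₂ ≡ v * t₂
    gy₂ = proj₂ (proj₂ multiple₂)
    gx₃ : g * x₃ ≡ (u + + 2) * t₃
    gx₃ = proj₁ (proj₂ multiple₃)
    gy₃ : g * y₃ ≡ v * t₃
    gy₃ = proj₂ (proj₂ multiple₃)

  entries⇒scalar⊎parametrised :
    ∀ {p u v} → b ≢ 0ℤ → Is5or7mod8 p → p ∣ ∣ b ∣ → IsU u → IsV v → x₁ + x₄ ≢ 0ℤ ⊎ y₁ + y₄ ≢ 0ℤ →
    (+ 0 < b × ScalarSolution b (mat x₁ x₂ x₃ x₄) (mat y₁ y₂ y₃ y₄))
    ⊎ (b < + 0 × ParametrisedSolution b (mat x₁ x₂ x₃ x₄) (mat y₁ y₂ y₃ y₄))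
  entries⇒scalar⊎parametrised {p} {u} {v} b≢0 p-5or7 p∣b u≡ v≡ not-traceless = by-sign (ℤ.<-cmp b 0ℤ)
    where
    κ = commute b≢0 not-traceless
    trY≢0 : y₁ + y₄ ≢ 0ℤ
    trY≢0 trY≡0 = [ (λ trX≢0 → trX≢0 (trY≡0⇒trX≡0 p-5or7 p∣b trY≡0)) , (λ trY≢0 → trY≢0 trY≡0) ]′ not-traceless
    u≢-2 : u ≢ - (+ 2)
    u≢-2 = trY≢0 ∘′ u≡-2⇒trY≡0 b≢0 κ u≡ v≡
    by-sign : Tri (b < 0ℤ) (b ≡ 0ℤ) (0ℤ < b) →
              (+ 0 < b × ScalarSolution b (mat x₁ x₂ x₃ x₄) (mat y₁ y₂ y₃ y₄))
              ⊎ (b < + 0 × ParametrisedSolution b (mat x₁ x₂ x₃ x₄) (mat y₁ y₂ y₃ y₄))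
    by-sign (tri< b<0 _ _) = inj₂ (b<0 , entries⇒parametrised κ u≡ v≡ u≢-2)
    by-sign (tri≈ _ b≡0 _) = contradiction b≡0 b≢0
    by-sign (tri> _ _ 0<b) = inj₁ (0<b , entries⇒scalar κ u≡ v≡ u≡2 v≡0)
      where
      5≤∣b∣ : 5 ℕ.≤ ∣ b ∣
      5≤∣b∣ = ℕ.≤-trans (5or7mod8⇒5≤ p-5or7) (ℕ.∣⇒≤ {{ℕ.≢-nonZero (b≢0 ∘′ ℤ.∣i∣≡0⇒i≡0)}} p∣b)
      v≡0 : v ≡ 0ℤ
      v≡0 = u²+bv²≡4⇒v≡0 {b} {u} {v} 0<b 5≤∣b∣ (norm κ u≡ v≡)
      u≡2 : u ≡ + 2
      u≡2 = [ (λ u≡2 → u≡2) , (λ u≡-2 → contradiction u≡-2 u≢-2) ]′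
              (u²+bv²≡4⇒u≡±2 {b} {u} {v} v≡0 (norm κ u≡ v≡))

  entries⇒classification : ∀ {p} → b ≢ 0ℤ → Is5or7mod8 p → p ∣ ∣ b ∣ →
                           Classification b (mat x₁ x₂ x₃ x₄) (mat y₁ y₂ y₃ y₄)
  entries⇒classification b≢0 p-5or7 p∣b with x₁ + x₄ ℤ.≟ 0ℤ | y₁ + y₄ ℤ.≟ 0ℤ
  ... | yes trX≡0 | yes trY≡0 = inj₁ (x₁ , x₂ , x₃ , y₁ , y₂ , y₃ ,
          cong (mat x₁ x₂ x₃) (i+j≡0⇒j≡-i trX≡0) , cong (mat y₁ y₂ y₃) (i+j≡0⇒j≡-i trY≡0) , e₁₁)
  ... | no trX≢0  | _         = inj₂ (entries⇒scalar⊎parametrised b≢0 p-5or7 p∣b refl refl (inj₁ trX≢0))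
  ... | yes _     | no trY≢0  = inj₂ (entries⇒scalar⊎parametrised b≢0 p-5or7 p∣b refl refl (inj₂ trY≢0))

-- Every member of a family is a solution

entries⇒solution : ∀ b x₁ x₂ x₃ x₄ y₁ y₂ y₃ y₄ →
                   x₁ * x₁ + x₂ * x₃ + b * (y₁ * y₁ + y₂ * y₃) ≡ - (+ 2) →
                   x₁ * x₂ + x₂ * x₄ + b * (y₁ * y₂ + y₂ * y₄) ≡ 0ℤ →
                   x₃ * x₁ + x₄ * x₃ + b * (y₃ * y₁ + y₄ * y₃) ≡ 0ℤ →
                   x₃ * x₂ + x₄ * x₄ + b * (y₃ * y₂ + y₄ * y₄) ≡ - (+ 2) →
                   Solution b (mat x₁ x₂ x₃ x₄) (mat y₁ y₂ y₃ y₄)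
entries⇒solution _ _ _ _ _ _ _ _ _ = entrywise

traceless⇒solution : ∀ {b} X Y → TracelessSolution b X Y → Solution b X Y
traceless⇒solution {b} _ _ (t₁ , t₂ , t₃ , s₁ , s₂ , s₃ , refl , refl , equation) =
  entries⇒solution b t₁ t₂ t₃ (- t₁) s₁ s₂ s₃ (- s₁) equation
    (ℤ-Solver.solve vars) (ℤ-Solver.solve vars)
    (linear-combination (equation ∷ []) (+ 1 ∷ []) (ℤ-Solver.solve vars))
  where
  vars : List ℤ
  vars = b ∷ t₁ ∷ t₂ ∷ t₃ ∷ s₁ ∷ s₂ ∷ s₃ ∷ []

scalar⇒solution : ∀ {b} X Y → ScalarSolution b X Y → Solution b X Y
scalar⇒solution {b} _ _ (t₁ , t₂ , t₃ , t₄ , refl , refl , equation) =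
  entries⇒solution b t₁ t₂ t₃ (- t₁) (t₄ * + 1) (t₄ * + 0) (t₄ * + 0) (t₄ * + 1)
    (linear-combination (equation ∷ []) (+ 1 ∷ []) (ℤ-Solver.solve vars))
    (ℤ-Solver.solve vars) (ℤ-Solver.solve vars)
    (linear-combination (equation ∷ []) (+ 1 ∷ []) (ℤ-Solver.solve vars))
  where
  vars : List ℤ
  vars = b ∷ t₁ ∷ t₂ ∷ t₃ ∷ t₄ ∷ []

parameters⇒solution :
  ∀ b g u v t₁ t₂ t₃ t₄ {x₂ x₃ x₄ y₂ y₃ y₄} → g ≢ 0ℤ →
  u * u + v * v * b ≡ + 4 →
  g * g * (t₁ * t₁ + b * (t₄ * t₄)) + + 4 * t₂ * t₃ * (+ 2 + u) ≡ - (+ 2) * (g * g) →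
  g * x₂ ≡ (u + + 2) * t₂ → g * x₃ ≡ (u + + 2) * t₃ → - (+ 2) * x₄ ≡ u * t₁ + v * b * t₄ →
  g * y₂ ≡ v * t₂ → g * y₃ ≡ v * t₃ → - (+ 2) * y₄ ≡ v * t₁ - u * t₄ →
  Solution b (mat t₁ x₂ x₃ x₄) (mat t₄ y₂ y₃ y₄)
parameters⇒solution b g u v t₁ t₂ t₃ t₄ {x₂} {x₃} {x₄} {y₂} {y₃} {y₄}
                    g≢0 norm condition gx₂ gx₃ x₄-relation gy₂ gy₃ y₄-relation =
  entries⇒solution b t₁ x₂ x₃ x₄ t₄ y₂ y₃ y₄
    (*-cancelˡ g²≢0 (linear-combination (condition ∷ norm ∷ gx₂ ∷ gx₃ ∷ gy₂ ∷ gy₃ ∷ [])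
      (+ 1 ∷ t₂ * t₃ ∷ g * x₃ ∷ (u + + 2) * t₂ ∷ b * g * y₃ ∷ b * v * t₂ ∷ []) (ℤ-Solver.solve vars)))
    (*-cancelˡ 2g≢0 (linear-combination (norm ∷ gx₂ ∷ x₄-relation ∷ gy₂ ∷ y₄-relation ∷ [])
      (- (t₁ * t₂) ∷ + 2 * t₁ + + 2 * x₄ ∷ - ((u + + 2) * t₂) ∷ b * (+ 2 * t₄ + + 2 * y₄) ∷ - (b * v * t₂) ∷ [])
      (ℤ-Solver.solve vars)))
    (*-cancelˡ 2g≢0 (linear-combination (norm ∷ gx₃ ∷ x₄-relation ∷ gy₃ ∷ y₄-relation ∷ [])
      (- (t₁ * t₃) ∷ + 2 * t₁ + + 2 * x₄ ∷ - ((u + + 2) * t₃) ∷ b * (+ 2 * t₄ + + 2 * y₄) ∷ - (b * v * t₃) ∷ [])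
      (ℤ-Solver.solve vars)))
    (*-cancelˡ 4g²≢0 (linear-combination
      (condition ∷ norm ∷ gx₂ ∷ gx₃ ∷ gy₂ ∷ gy₃ ∷ x₄-relation ∷ y₄-relation ∷ [])
      (+ 4 ∷ + 4 * t₂ * t₃ + g * g * (t₁ * t₁ + b * (t₄ * t₄)) ∷ + 4 * g * x₃ ∷ + 4 * (u + + 2) * t₂
       ∷ + 4 * b * g * y₃ ∷ + 4 * b * v * t₂ ∷ g * g * (- (+ 2) * x₄ + u * t₁ + v * b * t₄)
       ∷ b * g * g * (- (+ 2) * y₄ + v * t₁ - u * t₄) ∷ [])
      (ℤ-Solver.solve vars)))
  where
  vars : List ℤ
  vars = b ∷ g ∷ u ∷ v ∷ t₁ ∷ t₂ ∷ t₃ ∷ t₄ ∷ x₂ ∷ x₃ ∷ x₄ ∷ y₂ ∷ y₃ ∷ y₄ ∷ []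
  g²≢0 : g * g ≢ 0ℤ
  g²≢0 = i*j≢0 g≢0 g≢0
  2g≢0 : + 2 * g ≢ 0ℤ
  2g≢0 = i*j≢0 {+ 2} (λ ()) g≢0
  4g²≢0 : + 4 * (g * g) ≢ 0ℤ
  4g²≢0 = i*j≢0 {+ 4} (λ ()) g²≢0

parametrised⇒solution : ∀ {b} X Y → ParametrisedSolution b X Y → Solution b X Y
parametrised⇒solution {b} (mat _ _ _ _) (mat _ _ _ _)
  (t₁ , t₂ , t₃ , t₄ , u , v , u≢-2 , norm , condition , refl , gx₂ , gx₃ , x₄-relation , refl , gy₂ , gy₃ , y₄-relation) =
  parameters⇒solution b (gcd v (u + + 2)) u v t₁ t₂ t₃ t₄ g≢0 norm condition gx₂ gx₃ x₄-relation gy₂ gy₃ y₄-relation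
  where
  g≢0 : gcd v (u + + 2) ≢ 0ℤ
  g≢0 = u≢-2 ∘′ ℤ.i-j≡0⇒i≡j u (- (+ 2)) ∘′ ℤ.gcd[i,j]≡0⇒j≡0 {v} {u + + 2}

classification⇒solution : ∀ {b} X Y → Classification b X Y → Solution b X Y
classification⇒solution {b} X Y (inj₁ traceless)                 = traceless⇒solution {b} X Y traceless
classification⇒solution {b} X Y (inj₂ (inj₁ (_ , scalar)))       = scalar⇒solution {b} X Y scalar
classification⇒solution {b} X Y (inj₂ (inj₂ (_ , parametrised))) = parametrised⇒solution {b} X Y parametrised

proposition4p5 : (b : ℤ) → b ≢ + 0
    → ¬ (∃[ k ] (k * k ≡ - b))
    → (∃[ p ] (Prime p × p ∣ ∣ b ∣ × ((p % 8 ≡ 5) ⊎ (p % 8 ≡ 7))))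
    → (X Y : M2)
    → (sq X ⊕ b · sq Y ≡ (- (+ 2)) · I)
      ⇔ ((∃[ t₁ ] ∃[ t₂ ] ∃[ t₃ ] ∃[ s₁ ] ∃[ s₂ ] ∃[ s₃ ]
            (X ≡ mat t₁ t₂ t₃ (- t₁) × Y ≡ mat s₁ s₂ s₃ (- s₁)
             × t₁ * t₁ + t₂ * t₃ + b * (s₁ * s₁ + s₂ * s₃) ≡ - (+ 2)))
        ⊎ ((+ 0 < b × ∃[ t₁ ] ∃[ t₂ ] ∃[ t₃ ] ∃[ t₄ ]
              (X ≡ mat t₁ t₂ t₃ (- t₁) × Y ≡ t₄ · I
               × t₁ * t₁ + t₂ * t₃ + b * (t₄ * t₄) ≡ - (+ 2)))
          ⊎ (b < + 0 × ∃[ t₁ ] ∃[ t₂ ] ∃[ t₃ ] ∃[ t₄ ] ∃[ u ] ∃[ v ]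
              (u ≢ - (+ 2)
               × u * u + v * v * b ≡ + 4
               × gcd v (u + + 2) * gcd v (u + + 2) * (t₁ * t₁ + b * (t₄ * t₄))
                   + + 4 * t₂ * t₃ * (+ 2 + u)
                 ≡ - (+ 2) * (gcd v (u + + 2) * gcd v (u + + 2))
               × m11 X ≡ t₁
               × gcd v (u + + 2) * m12 X ≡ (u + + 2) * t₂
               × gcd v (u + + 2) * m21 X ≡ (u + + 2) * t₃
               × - (+ 2) * m22 X ≡ u * t₁ + v * b * t₄
               × m11 Y ≡ t₄
               × gcd v (u + + 2) * m12 Y ≡ v * t₂
               × gcd v (u + + 2) * m21 Y ≡ v * t₃
               × - (+ 2) * m22 Y ≡ v * t₁ - u * t₄))))
proposition4p5 b b≢0 _ (p , _ , p∣b , p-5or7) X@(mat x₁ x₂ x₃ x₄) Y@(mat y₁ y₂ y₃ y₄) =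
  mk⇔ classify (classification⇒solution {b} X Y)
  where
  classify : Solution b X Y → Classification b X Y
  classify solution =
    entries⇒classification b x₁ x₂ x₃ x₄ y₁ y₂ y₃ y₄
      (cong m11 solution) (cong m12 solution) (cong m21 solution) (cong m22 solution) b≢0 p-5or7 p∣b
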